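{- Let $n$ be a positive integer and let $a_1,a_2,\ldots,a_n$ be any integers. Then the number $$\sum_{k=1}^{n}\frac{n}{k}\sum_{\substack{\lambda_1+\lambda_2+\cdots+\lambda_k=n\\ \lambda_i>0}} a_{\lambda_1}a_{\lambda_2}\cdots a_{\lambda_k}$$ is an integer, where the inner sum runs over all ordered $k$-tuples $(\lambda_1,\ldots,\lambda_k)$ of positive integers with $\lambda_1+\cdots+\lambda_k=n$. -}

module Defs where

open import Data.Nat using (ℕ; zero; suc; _∸_)
open import Data.Integer using (ℤ; +_)
import Data.Integer as ℤ
open import Data.List using (List; []; _∷_; map; concatMap; foldr; upTo)
open import Data.Rational using (ℚ; _/_)
import Data.Rational as ℚ

compositions : ℕ → ℕ → List (List ℕ)
compositions zero zero    = [] ∷ []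
compositions zero (suc _) = []
compositions (suc k) n =
  concatMap (λ i → map (suc i ∷_) (compositions k (n ∸ suc i))) (upTo n)
-- first part p = suc i ranges over 1..n; the remainder n ∸ p is ≥ 0.

prodA : (ℕ → ℤ) → List ℕ → ℤ
prodA a = foldr (λ l r → a l ℤ.* r) (+ 1)

innerSum : (ℕ → ℤ) → ℕ → ℕ → ℤ
innerSum a n k = foldr ℤ._+_ (+ 0) (map (prodA a) (compositions k n))

outerSum : (ℕ → ℤ) → ℕ → ℚ
outerSum a n =
  foldr ℚ._+_ ℚ.0ℚ
    (map (λ i → ((+ n) / suc i) ℚ.* (innerSum a n (suc i) / 1)) (upTo n))

-- Let A(x) = Σ_{i≥1} aᵢ xⁱ. The inner sum for k is the coefficient cₖ(n) of xⁿ in A(x)ᵏ,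
-- and applying x d/dx to A(x)ᵏ gives the power rule  n cₖ(n) = k [xⁿ] (x A′(x) A(x)ᵏ⁻¹).
-- Hence each term (n/k) cₖ(n) of the outer sum is the integer coefficient [xⁿ] (x A′(x) A(x)ᵏ⁻¹).
module Submission where

open import Data.Nat using (ℕ; NonZero; zero; suc; _∸_; _≤_; _<_; z≤n; s≤s)
import Data.Nat as ℕ
import Data.Nat.Properties as ℕ
open import Data.Integer using (ℤ; +_; _+_; _*_)
import Data.Integer.Properties as ℤ
open import Data.Integer.Solver using (module +-*-Solver)
open import Data.Rational using (ℚ; _/_)
import Data.Rational as ℚ
import Data.Rational.Properties as ℚₚ
open import Data.Rational.Unnormalised using (mkℚᵘ; *≡*)
import Data.Rational.Unnormalised as ℚᵘ
import Data.Rational.Unnormalised.Properties as ℚᵘₚ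
open import Data.List using (List; []; _∷_; map; concatMap; foldr; upTo; applyUpTo; _++_)
import Data.List.Properties as List
open import Data.Product using (∃; _,_)
open import Relation.Binary.PropositionalEquality

open import Algebra.Properties.CommutativeSemigroup ℤ.+-commutativeSemigroup
  using () renaming (interchange to +-interchange)
open import Algebra.Properties.CommutativeSemigroup ℤ.*-commutativeSemigroup
  using () renaming (x∙yz≈y∙xz to *-lcomm)

open import Defs

open +-*-Solver using (solve; _:+_; _:*_; _:=_; con)
open ≡-Reasoning

∑< : ℕ → (ℕ → ℤ) → ℤ
∑< zero    f = + 0
∑< (suc n) f = f 0 + ∑< n (λ i → f (suc i))

syntax ∑< n (λ i → e) = ∑[ i < n ] e

∑-cong : ∀ n {f g : ℕ → ℤ} → (∀ i → i < n → f i ≡ g i) → ∑< n f ≡ ∑< n g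
∑-cong zero    f≡g = refl
∑-cong (suc n) f≡g = cong₂ _+_ (f≡g 0 (s≤s z≤n)) (∑-cong n (λ i i<n → f≡g (suc i) (s≤s i<n)))

∑-zero : ∀ n → ∑[ i < n ] (+ 0) ≡ + 0
∑-zero zero    = refl
∑-zero (suc n) = trans (ℤ.+-identityˡ _) (∑-zero n)

∑-+ : ∀ n (f g : ℕ → ℤ) → ∑[ i < n ] (f i + g i) ≡ ∑< n f + ∑< n g
∑-+ zero    f g = refl
∑-+ (suc n) f g =
  trans (cong (_+_ (f 0 + g 0)) (∑-+ n (λ i → f (suc i)) (λ i → g (suc i)))) (+-interchange (f 0) (g 0) _ _)

∑-*ˡ : ∀ n k (f : ℕ → ℤ) → ∑[ i < n ] (k * f i) ≡ k * ∑< n f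
∑-*ˡ zero    k f = sym (ℤ.*-zeroʳ k)
∑-*ˡ (suc n) k f =
  trans (cong (_+_ (k * f 0)) (∑-*ˡ n k _)) (sym (ℤ.*-distribˡ-+ k (f 0) _))

∑-last : ∀ n (f : ℕ → ℤ) → ∑< (suc n) f ≡ ∑< n f + f n
∑-last zero    f = trans (ℤ.+-identityʳ (f 0)) (sym (ℤ.+-identityˡ (f 0)))
∑-last (suc n) f =
  trans (cong (_+_ (f 0)) (∑-last n (λ i → f (suc i)))) (sym (ℤ.+-assoc (f 0) _ _))

∑△ : ℕ → (ℕ → ℕ → ℤ) → ℤ
∑△ n f = ∑[ i < suc n ] ∑< (suc (n ∸ i)) (f i)

∑△-peelʳ : ∀ n f → ∑△ (suc n) f ≡ ∑[ i < suc (suc n) ] f i 0 + ∑△ n (λ i j → f i (suc j))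
∑△-peelʳ n f = begin
  ∑△ (suc n) f
    ≡⟨ ∑-+ (suc (suc n)) (λ i → f i 0) rest ⟩
  col + ∑< (suc (suc n)) rest
    ≡⟨ cong (_+_ col) (∑-last (suc n) rest) ⟩
  col + (∑< (suc n) rest + ∑< (suc n ∸ suc n) (λ j → f (suc n) (suc j)))
    ≡⟨ cong (λ m → col + (∑< (suc n) rest + ∑< m (λ j → f (suc n) (suc j)))) (ℕ.n∸n≡0 n) ⟩
  col + (∑< (suc n) rest + + 0)
    ≡⟨ cong (_+_ col) (ℤ.+-identityʳ _) ⟩
  col + ∑< (suc n) rest
    ≡⟨ cong (_+_ col) (∑-cong (suc n) λ i i≤n →
         cong (λ m → ∑< m (λ j → f i (suc j))) (ℕ.+-∸-assoc 1 (ℕ.≤-pred i≤n))) ⟩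
  col + ∑△ n (λ i j → f i (suc j))
    ∎
  where
  col : ℤ
  col = ∑[ i < suc (suc n) ] f i 0
  rest : ℕ → ℤ
  rest i = ∑[ j < suc n ∸ i ] f i (suc j)

∑△-swap : ∀ n f → ∑△ n f ≡ ∑△ n (λ i j → f j i)
∑△-swap zero    f = refl
∑△-swap (suc n) f = begin
  ∑< (suc (suc n)) (f 0) + ∑△ n (λ i j → f (suc i) j)
    ≡⟨ cong (_+_ (∑< (suc (suc n)) (f 0))) (∑△-swap n (λ i j → f (suc i) j)) ⟩
  ∑< (suc (suc n)) (f 0) + ∑△ n (λ i j → f (suc j) i)
    ≡⟨ ∑△-peelʳ n (λ i j → f j i) ⟨
  ∑△ (suc n) (λ i j → f j i)
    ∎

infixr 7 _⋆_
_⋆_ : (ℕ → ℤ) → (ℕ → ℤ) → ℕ → ℤ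
(f ⋆ g) n = ∑[ i < suc n ] (f i * g (n ∸ i))

⋆-congʳ : ∀ f {g h : ℕ → ℤ} n → (∀ m → g m ≡ h m) → (f ⋆ g) n ≡ (f ⋆ h) n
⋆-congʳ f n g≗h = ∑-cong (suc n) (λ i _ → cong (f i *_) (g≗h (n ∸ i)))

⋆-zeroʳ : ∀ f n → (f ⋆ λ _ → + 0) n ≡ + 0
⋆-zeroʳ f n = trans (∑-cong (suc n) (λ i _ → ℤ.*-zeroʳ (f i))) (∑-zero (suc n))

⋆-*ʳ : ∀ f k g n → (f ⋆ λ m → k * g m) n ≡ k * (f ⋆ g) n
⋆-*ʳ f k g n =
  trans (∑-cong (suc n) (λ i _ → *-lcomm (f i) k (g (n ∸ i)))) (∑-*ˡ (suc n) k (λ i → f i * g (n ∸ i)))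

⋆-⋆≡∑△ : ∀ f g h n → (f ⋆ g ⋆ h) n ≡ ∑△ n (λ i j → f i * (g j * h (n ∸ i ∸ j)))
⋆-⋆≡∑△ f g h n = ∑-cong (suc n) (λ i _ → sym (∑-*ˡ (suc (n ∸ i)) (f i) (λ j → g j * h (n ∸ i ∸ j))))

⋆-lcomm : ∀ f g h n → (f ⋆ g ⋆ h) n ≡ (g ⋆ f ⋆ h) n
⋆-lcomm f g h n = begin
  (f ⋆ g ⋆ h) n
    ≡⟨ ⋆-⋆≡∑△ f g h n ⟩
  ∑△ n (λ i j → f i * (g j * h (n ∸ i ∸ j)))
    ≡⟨ ∑△-swap n (λ i j → f i * (g j * h (n ∸ i ∸ j))) ⟩
  ∑△ n (λ i j → f j * (g i * h (n ∸ j ∸ i)))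
    ≡⟨ ∑-cong (suc n) (λ i _ → ∑-cong (suc (n ∸ i)) (λ j _ →
         trans (*-lcomm (f j) (g i) _) (cong (λ m → g i * (f j * h m)) (∸-comm j i)))) ⟩
  ∑△ n (λ i j → g i * (f j * h (n ∸ i ∸ j)))
    ≡⟨ ⋆-⋆≡∑△ g f h n ⟨
  (g ⋆ f ⋆ h) n
    ∎
  where
  ∸-comm : ∀ i j → n ∸ i ∸ j ≡ n ∸ j ∸ i
  ∸-comm i j = trans (ℕ.∸-+-assoc n i j) (trans (cong (n ∸_) (ℕ.+-comm i j)) (sym (ℕ.∸-+-assoc n j i)))

δ : (ℕ → ℤ) → ℕ → ℤ
δ f n = + n * f n

δ-⋆ : ∀ f g n → δ (f ⋆ g) n ≡ (δ f ⋆ g) n + (f ⋆ δ g) n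
δ-⋆ f g n = begin
  + n * (f ⋆ g) n
    ≡⟨ ∑-*ˡ (suc n) (+ n) (λ i → f i * g (n ∸ i)) ⟨
  ∑[ i < suc n ] (+ n * (f i * g (n ∸ i)))
    ≡⟨ ∑-cong (suc n) (λ i i≤n → leibniz i (ℕ.≤-pred i≤n)) ⟩
  ∑[ i < suc n ] (δ f i * g (n ∸ i) + f i * δ g (n ∸ i))
    ≡⟨ ∑-+ (suc n) (λ i → δ f i * g (n ∸ i)) (λ i → f i * δ g (n ∸ i)) ⟩
  (δ f ⋆ g) n + (f ⋆ δ g) n
    ∎
  where
  split : ∀ x y a b → (x + y) * (a * b) ≡ (x * a) * b + a * (y * b)
  split = solve 4 (λ x y a b → (x :+ y) :* (a :* b) := (x :* a) :* b :+ a :* (y :* b)) refl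
  leibniz : ∀ i → i ≤ n → + n * (f i * g (n ∸ i)) ≡ δ f i * g (n ∸ i) + f i * δ g (n ∸ i)
  leibniz i i≤n = begin
    + n * (f i * g (n ∸ i))               ≡⟨ cong (λ m → + m * (f i * g (n ∸ i))) (ℕ.m+[n∸m]≡n i≤n) ⟨
    + (i ℕ.+ (n ∸ i)) * (f i * g (n ∸ i)) ≡⟨ cong (_* (f i * g (n ∸ i))) (ℤ.pos-+ i (n ∸ i)) ⟩
    (+ i + + (n ∸ i)) * (f i * g (n ∸ i)) ≡⟨ split (+ i) (+ (n ∸ i)) (f i) (g (n ∸ i)) ⟩
    δ f i * g (n ∸ i) + f i * δ g (n ∸ i) ∎

infix 8 _⋆^_
_⋆^_ : (ℕ → ℤ) → ℕ → ℕ → ℤ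
(f ⋆^ zero)  zero    = + 1
(f ⋆^ zero)  (suc _) = + 0
(f ⋆^ suc k) n       = (f ⋆ f ⋆^ k) n

δ-⋆^-zero : ∀ f n → δ (f ⋆^ 0) n ≡ + 0
δ-⋆^-zero f zero    = refl
δ-⋆^-zero f (suc n) = ℤ.*-zeroʳ (+ suc n)

δ-⋆^ : ∀ f k n → δ (f ⋆^ suc k) n ≡ + suc k * (δ f ⋆ f ⋆^ k) n
δ-⋆^ f zero n = begin
  δ (f ⋆ f ⋆^ 0) n                        ≡⟨ δ-⋆ f (f ⋆^ 0) n ⟩
  D + (f ⋆ δ (f ⋆^ 0)) n                  ≡⟨ cong (_+_ D) (⋆-congʳ f n (δ-⋆^-zero f)) ⟩
  D + (f ⋆ λ _ → + 0) n                   ≡⟨ cong (_+_ D) (⋆-zeroʳ f n) ⟩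
  D + + 0                                 ≡⟨ ℤ.+-identityʳ D ⟩
  D                                       ≡⟨ ℤ.*-identityˡ D ⟨
  + 1 * D                                 ∎
  where
  D : ℤ
  D = (δ f ⋆ f ⋆^ 0) n
δ-⋆^ f (suc k) n = begin
  δ (f ⋆ f ⋆^ suc k) n                                  ≡⟨ δ-⋆ f (f ⋆^ suc k) n ⟩
  D + (f ⋆ δ (f ⋆^ suc k)) n                            ≡⟨ cong (_+_ D) (⋆-congʳ f n (δ-⋆^ f k)) ⟩
  D + (f ⋆ λ m → + suc k * (δ f ⋆ f ⋆^ k) m) n          ≡⟨ cong (_+_ D) (⋆-*ʳ f (+ suc k) (δ f ⋆ f ⋆^ k) n) ⟩
  D + + suc k * (f ⋆ δ f ⋆ f ⋆^ k) n                    ≡⟨ cong (λ m → D + + suc k * m) (⋆-lcomm f (δ f) (f ⋆^ k) n) ⟩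
  D + + suc k * D                                       ≡⟨ ℤ.suc-* (+ suc k) D ⟨
  + suc (suc k) * D                                     ∎
  where
  D : ℤ
  D = (δ f ⋆ f ⋆^ suc k) n

sumℤ : List ℤ → ℤ
sumℤ = foldr _+_ (+ 0)

sumℤ-++ : ∀ xs ys → sumℤ (xs ++ ys) ≡ sumℤ xs + sumℤ ys
sumℤ-++ []       ys = sym (ℤ.+-identityˡ (sumℤ ys))
sumℤ-++ (x ∷ xs) ys = trans (cong (_+_ x) (sumℤ-++ xs ys)) (sym (ℤ.+-assoc x _ _))

sumℤ-applyUpTo : ∀ (g : ℕ → ℤ) h n → sumℤ (map g (applyUpTo h n)) ≡ ∑[ i < n ] g (h i)
sumℤ-applyUpTo g h zero    = refl
sumℤ-applyUpTo g h (suc n) = cong (_+_ (g (h 0))) (sumℤ-applyUpTo g (λ i → h (suc i)) n)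

module _ (a : ℕ → ℤ) where

  sumℤ-prodA-cons : ∀ x L → sumℤ (map (prodA a) (map (x ∷_) L)) ≡ a x * sumℤ (map (prodA a) L)
  sumℤ-prodA-cons x []      = sym (ℤ.*-zeroʳ (a x))
  sumℤ-prodA-cons x (l ∷ L) =
    trans (cong (_+_ (a x * prodA a l)) (sumℤ-prodA-cons x L)) (sym (ℤ.*-distribˡ-+ (a x) _ _))

  innerSum-suc : ∀ k n → innerSum a n (suc k) ≡ ∑[ i < n ] (a (suc i) * innerSum a (n ∸ suc i) k)
  innerSum-suc k n =
    trans (byFirstPart (upTo n))
          (sumℤ-applyUpTo (λ i → a (suc i) * innerSum a (n ∸ suc i) k) (λ i → i) n)
    where
    byFirstPart : ∀ is →
      sumℤ (map (prodA a) (concatMap (λ i → map (suc i ∷_) (compositions k (n ∸ suc i))) is))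
        ≡ sumℤ (map (λ i → a (suc i) * innerSum a (n ∸ suc i) k) is)
    byFirstPart []       = refl
    byFirstPart (i ∷ is) = begin
      sumℤ (map (prodA a) (map (suc i ∷_) Lᵢ ++ rest))
        ≡⟨ cong sumℤ (List.map-++ (prodA a) (map (suc i ∷_) Lᵢ) rest) ⟩
      sumℤ (map (prodA a) (map (suc i ∷_) Lᵢ) ++ map (prodA a) rest)
        ≡⟨ sumℤ-++ (map (prodA a) (map (suc i ∷_) Lᵢ)) (map (prodA a) rest) ⟩
      sumℤ (map (prodA a) (map (suc i ∷_) Lᵢ)) + sumℤ (map (prodA a) rest)
        ≡⟨ cong₂ _+_ (sumℤ-prodA-cons (suc i) Lᵢ) (byFirstPart is) ⟩
      a (suc i) * innerSum a (n ∸ suc i) k + sumℤ (map (λ i → a (suc i) * innerSum a (n ∸ suc i) k) is)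
        ∎
      where
      Lᵢ rest : List (List ℕ)
      Lᵢ = compositions k (n ∸ suc i)
      rest = concatMap (λ i → map (suc i ∷_) (compositions k (n ∸ suc i))) is

  -- The coefficients of A(x) = Σ_{i≥1} aᵢ xⁱ; the value a 0 is never used by innerSum.
  â : ℕ → ℤ
  â zero    = + 0
  â (suc i) = a (suc i)

  innerSum≡⋆^ : ∀ k n → innerSum a n k ≡ (â ⋆^ k) n
  innerSum≡⋆^ zero    zero    = refl
  innerSum≡⋆^ zero    (suc n) = refl
  innerSum≡⋆^ (suc k) n       = begin
    innerSum a n (suc k)
      ≡⟨ innerSum-suc k n ⟩
    ∑[ i < n ] (a (suc i) * innerSum a (n ∸ suc i) k)
      ≡⟨ ∑-cong n (λ i _ → cong (a (suc i) *_) (innerSum≡⋆^ k (n ∸ suc i))) ⟩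
    ∑[ i < n ] (â (suc i) * (â ⋆^ k) (n ∸ suc i))
      ≡⟨ ℤ.+-identityˡ _ ⟨
    + 0 + ∑[ i < n ] (â (suc i) * (â ⋆^ k) (n ∸ suc i))
      ≡⟨ cong (_+ ∑[ i < n ] (â (suc i) * (â ⋆^ k) (n ∸ suc i))) (ℤ.*-zeroˡ ((â ⋆^ k) n)) ⟨
    (â ⋆ â ⋆^ k) n
      ∎

  innerSum-power-rule : ∀ k n → + n * innerSum a n (suc k) ≡ + suc k * (δ â ⋆ â ⋆^ k) n
  innerSum-power-rule k n = trans (cong (λ c → + n * c) (innerSum≡⋆^ (suc k) n)) (δ-⋆^ â k n)

fromℚᵘ-homo-+ : ∀ p q → ℚ.fromℚᵘ (p ℚᵘ.+ q) ≡ ℚ.fromℚᵘ p ℚ.+ ℚ.fromℚᵘ q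
fromℚᵘ-homo-+ p q = ℚₚ.toℚᵘ-injective
  (ℚᵘₚ.≃-trans (ℚₚ.toℚᵘ-fromℚᵘ (p ℚᵘ.+ q))
  (ℚᵘₚ.≃-trans (ℚᵘₚ.+-cong (ℚᵘₚ.≃-sym (ℚₚ.toℚᵘ-fromℚᵘ p)) (ℚᵘₚ.≃-sym (ℚₚ.toℚᵘ-fromℚᵘ q)))
               (ℚᵘₚ.≃-sym (ℚₚ.toℚᵘ-homo-+ (ℚ.fromℚᵘ p) (ℚ.fromℚᵘ q)))))

fromℚᵘ-homo-* : ∀ p q → ℚ.fromℚᵘ (p ℚᵘ.* q) ≡ ℚ.fromℚᵘ p ℚ.* ℚ.fromℚᵘ q
fromℚᵘ-homo-* p q = ℚₚ.toℚᵘ-injective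
  (ℚᵘₚ.≃-trans (ℚₚ.toℚᵘ-fromℚᵘ (p ℚᵘ.* q))
  (ℚᵘₚ.≃-trans (ℚᵘₚ.*-cong (ℚᵘₚ.≃-sym (ℚₚ.toℚᵘ-fromℚᵘ p)) (ℚᵘₚ.≃-sym (ℚₚ.toℚᵘ-fromℚᵘ q)))
               (ℚᵘₚ.≃-sym (ℚₚ.toℚᵘ-homo-* (ℚ.fromℚᵘ p) (ℚ.fromℚᵘ q)))))

/1-+ : ∀ p q → p / 1 ℚ.+ q / 1 ≡ (p + q) / 1
/1-+ p q = trans (sym (fromℚᵘ-homo-+ (mkℚᵘ p 0) (mkℚᵘ q 0)))
                 (ℚₚ.fromℚᵘ-cong {mkℚᵘ p 0 ℚᵘ.+ mkℚᵘ q 0} {mkℚᵘ (p + q) 0} (*≡* (identity p q)))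
  where
  identity : ∀ p q → (p * + 1 + q * + 1) * + 1 ≡ (p + q) * + 1
  identity = solve 2 (λ p q → (p :* con (+ 1) :+ q :* con (+ 1)) :* con (+ 1)
                            := (p :+ q) :* con (+ 1)) refl

/-*-/1≡/1 : ∀ m d c z → + m * c ≡ + suc d * z → (+ m / suc d) ℚ.* (c / 1) ≡ z / 1
/-*-/1≡/1 m d c z mc≡dz =
  trans (sym (fromℚᵘ-homo-* (mkℚᵘ (+ m) d) (mkℚᵘ c 0)))
        (ℚₚ.fromℚᵘ-cong {mkℚᵘ (+ m) d ℚᵘ.* mkℚᵘ c 0} {mkℚᵘ z 0} (*≡* cross))
  where
  cross : (+ m * c) * + 1 ≡ z * + suc (d ℕ.* 1)
  cross = begin
    (+ m * c) * + 1       ≡⟨ ℤ.*-identityʳ (+ m * c) ⟩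
    + m * c               ≡⟨ mc≡dz ⟩
    + suc d * z           ≡⟨ ℤ.*-comm (+ suc d) z ⟩
    z * + suc d           ≡⟨ cong (λ e → z * + suc e) (ℕ.*-identityʳ d) ⟨
    z * + suc (d ℕ.* 1)   ∎

sumℚ-/1 : ∀ (f : ℕ → ℚ) (g : ℕ → ℤ) → (∀ i → f i ≡ g i / 1) →
          ∀ is → foldr ℚ._+_ ℚ.0ℚ (map f is) ≡ sumℤ (map g is) / 1
sumℚ-/1 f g f≡g/1 []       = refl
sumℚ-/1 f g f≡g/1 (i ∷ is) = trans (cong₂ ℚ._+_ (f≡g/1 i) (sumℚ-/1 f g f≡g/1 is)) (/1-+ (g i) _)

theorem2 : (n : ℕ) → .{{_ : NonZero n}} → (a : ℕ → ℤ) →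
    ∃ λ (z : ℤ) → outerSum a n ≡ z / 1
theorem2 n a = sumℤ (map quotient (upTo n)) , sumℚ-/1 _ quotient term (upTo n)
  where
  quotient : ℕ → ℤ
  quotient k = (δ (â a) ⋆ â a ⋆^ k) n
  term : ∀ k → (+ n / suc k) ℚ.* (innerSum a n (suc k) / 1) ≡ quotient k / 1
  term k = /-*-/1≡/1 n k (innerSum a n (suc k)) (quotient k) (innerSum-power-rule a k n)
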